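{- Let $m,n\ge2$ be integers, $R=[0,m-1]\times[0,n-1]$, and $u\in\ker BW\setminus\{0\}$. Then every point of $A_u$ which is not a corner of $R$ is adjacent (in the adjacency relation on $A_u$) to at least two points of $A_u$. Moreover, if $b_1,b_2,b_3,b_4$ are four distinct points of $A_u$ with $b_1$ adjacent to $b_2$ and $b_3$ adjacent to $b_4$, then the closed segments $\overline{b_1b_2}$ and $\overline{b_3b_4}$ do not intersect.
   Context: $G=R\cap\mathbb{Z}^2$ is the $m\times n$ rectangular graph, with $(x,y),(x',y')$ adjacent in $G$ iff $|x-x'|+|y-y'|=1$; a point is black if $x+y$ is even, white otherwise. $BW$ maps a $\mathbb{Z}/(2)$-valued function $u$ on black points of $G$ to the function on white points $w\mapsto\sum_{b\text{ black neighbor of }w}u(b)\pmod 2$. For $u\in\ker BW\setminus\{0\}$, $A_u$ is the set of black points $b$ with $u(b)=1$ (active points). Two points $b_1,b_2\in A_u$ are adjacent in $A_u$ if (i) they have a common white neighbor $w$ in $G$, and (ii) either the segments $\overline{wb_1}$ and $\overline{wb_2}$ are perpendicular, or $b_1,b_2$ are the only points of $A_u$ among the neighbors of $w$. -}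

module Defs where

open import Data.Bool using (Bool; true; false; _xor_)
open import Data.Nat using (ℕ; _%_)
import Data.Nat as N
open import Data.Integer as Z using (ℤ; +_; _+_; _-_; _*_; ∣_∣; _<_; _≤_)
open import Data.Product using (_×_; _,_; Σ; ∃; ∃-syntax; proj₁; proj₂)
open import Data.Sum using (_⊎_)
open import Relation.Binary.PropositionalEquality using (_≡_; _≢_)
import Data.Rational as Q

Point : Set
Point = ℤ × ℤ

InR : ℕ → ℕ → Point → Set
InR m n (x , y) = (+ 0 ≤ x × x < + m) × (+ 0 ≤ y × y < + n)

Black : Point → Set
Black (x , y) = ∣ x + y ∣ % 2 ≡ 0

White : Point → Set
White (x , y) = ∣ x + y ∣ % 2 ≡ 1

GridAdj : Point → Point → Set
GridAdj (x , y) (x' , y') = ∣ x - x' ∣ N.+ ∣ y - y' ∣ ≡ 1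

-- A Z/2-valued function on the black points of G is represented by a
-- Bool-valued function on Z^2 that vanishes outside the black points of G
-- (Bool with xor is Z/2).
BlackFun : ℕ → ℕ → (Point → Bool) → Set
BlackFun m n u = ∀ p → u p ≡ true → InR m n p × Black p

-- BW u (w) = sum over black neighbours of w of u, mod 2.
-- Since u vanishes off the black points of G, this is the xor over the four
-- lattice neighbours of w.
BW : (Point → Bool) → Point → Bool
BW u (x , y) =
  u (x + + 1 , y) xor u (x - + 1 , y) xor u (x , y + + 1) xor u (x , y - + 1)

InKerBW : ℕ → ℕ → (Point → Bool) → Set
InKerBW m n u = ∀ w → InR m n w → White w → BW u w ≡ false

NonZero : (Point → Bool) → Set
NonZero u = ∃[ p ] u p ≡ true

Active : (Point → Bool) → Point → Set
Active u p = u p ≡ true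

dotAt : Point → Point → Point → ℤ
dotAt (wx , wy) (x1 , y1) (x2 , y2) = (x1 - wx) * (x2 - wx) + (y1 - wy) * (y2 - wy)

AdjA : ℕ → ℕ → (Point → Bool) → Point → Point → Set
AdjA m n u b₁ b₂ =
  Active u b₁ × Active u b₂ × b₁ ≢ b₂ ×
  ∃[ w ] (InR m n w × White w × GridAdj w b₁ × GridAdj w b₂ ×
          (dotAt w b₁ b₂ ≡ + 0
           ⊎ (∀ b → GridAdj w b → Active u b → b ≡ b₁ ⊎ b ≡ b₂)))

Corner : ℕ → ℕ → Point → Set
Corner m n p =
  (p ≡ (+ 0 , + 0)) ⊎ (p ≡ (+ (m N.∸ 1) , + 0)) ⊎
  (p ≡ (+ 0 , + (n N.∸ 1))) ⊎ (p ≡ (+ (m N.∸ 1) , + (n N.∸ 1)))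

toℚ : ℤ → Q.ℚ
toℚ z = z Q./ 1

-- the closed segments [p1,p2] and [p3,p4] (in R^2) share a point; for
-- lattice endpoints this is witnessed by rational parameters.
SegmentsMeet : Point → Point → Point → Point → Set
SegmentsMeet (x1 , y1) (x2 , y2) (x3 , y3) (x4 , y4) =
  ∃[ s ] ∃[ t ]
    (Q.0ℚ Q.≤ s × s Q.≤ Q.1ℚ × Q.0ℚ Q.≤ t × t Q.≤ Q.1ℚ ×
     toℚ x1 Q.+ s Q.* (toℚ x2 Q.- toℚ x1) ≡ toℚ x3 Q.+ t Q.* (toℚ x4 Q.- toℚ x3) ×
     toℚ y1 Q.+ s Q.* (toℚ y2 Q.- toℚ y1) ≡ toℚ y3 Q.+ t Q.* (toℚ y4 Q.- toℚ y3))

-- At a white point w of R the kernel condition says that an even number of the four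
-- neighbours of w are active. So if b is active and w = b + e lies in R, then either a
-- neighbour of w perpendicular to e is active, or else b + 2e is the only other active
-- neighbour of w; in both cases b gets an adjacent point c lying strictly beyond b in
-- direction e. A point of R that is not a corner has two opposite neighbours b ± e in R,
-- and the two points obtained lie on opposite sides of b.
--
-- An adjacent pair b₁, b₂ consists of two neighbours of a white point w, and b₃, b₄ of
-- two neighbours of a white point w′; the offset v = w′ − w has even coordinate sum, and
-- if v = 0 condition (ii), applied to the third active neighbour b₃ of w, makes b₁, b₂
-- perpendicular. If a coordinate of v has absolute value at least 3, that coordinate
-- strictly separates the endpoints of the two segments. The remaining configurations,
-- translated so that w = 0, are finitely many and checked by evaluation: in each one,
-- one of ±x, ±y, ±x ± y strictly separates the endpoints. A linear functional that
-- strictly separates the endpoints separates the segments, as one sees after clearing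
-- the denominators of the rational parameters of a common point.

{-# OPTIONS --safe #-}
module Submission where

open import Defs
open import Data.Bool using (Bool; true; false; _xor_)
open import Data.List using (List; []; _∷_)
open import Data.List.Membership.Propositional using (_∈_)
open import Data.List.Relation.Unary.All using (All; all?; lookup)
open import Data.List.Relation.Unary.Any using (Any; here; there; any?; satisfied)
open import Data.Nat as ℕ using (ℕ; zero; suc; _≥_; _%_; z≤n; s≤s)
import Data.Nat.Properties as ℕP
open import Data.Nat.DivMod using (%-distribˡ-+; [m+kn]%n≡m%n)
open import Data.Integer as ℤ
  using (ℤ; +_; -[1+_]; _⊖_; _+_; _-_; _*_; -_; ∣_∣; _<_; _≤_; _⊔_; _⊓_; +≤+; -≤-; +<+; -<+; nonNegative; positive)
import Data.Integer.Properties as ℤP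
open import Data.Integer.Tactic.RingSolver using (solve-∀; solve)
open import Data.Product using (_×_; _,_; proj₁; proj₂; ∃-syntax)
import Data.Product.Properties as ×P
import Data.Rational as ℚ
import Data.Rational.Properties as ℚP
open import Data.Rational.Unnormalised as ℚᵘ using (ℚᵘ; mkℚᵘ; _≃_) renaming (_+_ to _+ᵘ_; _-_ to _-ᵘ_; _*_ to _*ᵘ_)
import Data.Rational.Unnormalised.Properties as ℚᵘP
open import Data.Sum using (_⊎_; inj₁; inj₂; [_,_])
open import Data.Empty using (⊥; ⊥-elim)
open import Function using (_∘_)
open import Relation.Nullary using (¬_; Dec; yes; no; contradiction)
open import Relation.Nullary.Decidable using (from-yes; map′; _×-dec_; _⊎-dec_; _→-dec_; ¬?)
open import Relation.Binary.PropositionalEquality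
  using (_≡_; _≢_; refl; sym; trans; cong; cong₂; subst; subst₂; module ≡-Reasoning)

infixl 6 _+ᵖ_ _-ᵖ_
infixl 7 _·_

_+ᵖ_ : Point → Point → Point
(x , y) +ᵖ (x′ , y′) = (x + x′ , y + y′)

_-ᵖ_ : Point → Point → Point
(x , y) -ᵖ (x′ , y′) = (x - x′ , y - y′)

-ᵖ_ : Point → Point
-ᵖ (x , y) = (- x , - y)

_·_ : Point → Point → ℤ
(a , b) · (x , y) = a * x + b * y

0ᵖ : Point
0ᵖ = (+ 0 , + 0)

_≟ᵖ_ : (p q : Point) → Dec (p ≡ q)
_≟ᵖ_ = ×P.≡-dec ℤP._≟_ ℤP._≟_

·-distrib-+ᵖ : ∀ ℓ p q → ℓ · (p +ᵖ q) ≡ ℓ · p + ℓ · q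
·-distrib-+ᵖ (a , b) (x , y) (x′ , y′) = begin
  a * (x + x′) + b * (y + y′)          ≡⟨ solve (a ∷ b ∷ x ∷ y ∷ x′ ∷ y′ ∷ []) ⟩
  (a * x + b * y) + (a * x′ + b * y′)  ∎
  where open ≡-Reasoning

·-negˡ : ∀ ℓ p → (-ᵖ ℓ) · p ≡ - (ℓ · p)
·-negˡ (a , b) (x , y) = begin
  - a * x + - b * y  ≡⟨ solve (a ∷ b ∷ x ∷ y ∷ []) ⟩
  - (a * x + b * y)  ∎
  where open ≡-Reasoning

+ᵖ-cancelʳ : ∀ p q → p +ᵖ q +ᵖ -ᵖ q ≡ p
+ᵖ-cancelʳ (x , y) (a , b) = cong₂ _,_ (cancel x a) (cancel y b)
  where
  cancel : ∀ x a → x + a + - a ≡ x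
  cancel = solve-∀

dotAt-+ᵖ : ∀ w p q → dotAt w (w +ᵖ p) (w +ᵖ q) ≡ p · q
dotAt-+ᵖ (x , y) (a , b) (a′ , b′) = begin
  (x + a - x) * (x + a′ - x) + (y + b - y) * (y + b′ - y)  ≡⟨ solve (x ∷ y ∷ a ∷ b ∷ a′ ∷ b′ ∷ []) ⟩
  a * a′ + b * b′                                          ∎
  where open ≡-Reasoning

+ᵖ-rebase : ∀ w w′ r → w +ᵖ (w′ -ᵖ w +ᵖ r) ≡ w′ +ᵖ r
+ᵖ-rebase (x , y) (x′ , y′) (a , b) = cong₂ _,_ (rebase x x′ a) (rebase y y′ b)
  where
  rebase : ∀ x x′ a → x + (x′ - x + a) ≡ x′ + a
  rebase = solve-∀

-ᵖ≡0ᵖ⇒≡ : ∀ p q → p -ᵖ q ≡ 0ᵖ → p ≡ q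
-ᵖ≡0ᵖ⇒≡ (x , y) (x′ , y′) eq =
  cong₂ _,_ (ℤP.i-j≡0⇒i≡j x x′ (cong proj₁ eq)) (ℤP.i-j≡0⇒i≡j y y′ (cong proj₂ eq))

-- The four lattice directions

data Dir : Set where
  E W N S : Dir

vec : Dir → Point
vec E = (+ 1 , + 0)
vec W = (-[1+ 0 ] , + 0)
vec N = (+ 0 , + 1)
vec S = (+ 0 , -[1+ 0 ])

infixl 6 _⊕_

_⊕_ : Point → Dir → Point
p ⊕ d = p +ᵖ vec d

rot : Dir → Dir
rot E = N
rot N = W
rot W = S
rot S = E

opp : Dir → Dir
opp d = rot (rot d)

vec-opp : ∀ d → vec (opp d) ≡ -ᵖ vec d
vec-opp E = refl
vec-opp W = refl
vec-opp N = refl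
vec-opp S = refl

⊕-opp : ∀ p d → p ⊕ d ⊕ opp d ≡ p
⊕-opp p d = trans (cong (p ⊕ d +ᵖ_) (vec-opp d)) (+ᵖ-cancelʳ p (vec d))

∀-Dir? : {P : Dir → Set} → (∀ d → Dec (P d)) → Dec (∀ d → P d)
∀-Dir? P? = map′ (λ (pE , pW , pN , pS) → λ { E → pE ; W → pW ; N → pN ; S → pS })
                 (λ p → p E , p W , p N , p S)
                 (P? E ×-dec P? W ×-dec P? N ×-dec P? S)

dir-cases : ∀ e d → vec d ≡ vec e ⊎ vec d ≡ vec (opp e) ⊎ vec d ≡ vec (rot e) ⊎ vec d ≡ vec (opp (rot e))
dir-cases = from-yes (∀-Dir? λ e → ∀-Dir? λ d →
  (vec d ≟ᵖ vec e) ⊎-dec (vec d ≟ᵖ vec (opp e)) ⊎-dec (vec d ≟ᵖ vec (rot e)) ⊎-dec (vec d ≟ᵖ vec (opp (rot e))))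

·-table : ∀ e → vec e · vec e ≡ + 1 × vec e · vec (opp e) ≡ -[1+ 0 ]
              × vec e · vec (rot e) ≡ + 0 × vec e · vec (opp (rot e)) ≡ + 0
              × vec (opp e) · vec (rot e) ≡ + 0 × vec (opp e) · vec (opp (rot e)) ≡ + 0
·-table E = refl , refl , refl , refl , refl , refl
·-table W = refl , refl , refl , refl , refl , refl
·-table N = refl , refl , refl , refl , refl , refl
·-table S = refl , refl , refl , refl , refl , refl

norm₁ : Point → ℕ
norm₁ (x , y) = ∣ x ∣ ℕ.+ ∣ y ∣

norm₁-vec : ∀ d → norm₁ (vec d) ≡ 1
norm₁-vec E = refl
norm₁-vec W = refl
norm₁-vec N = refl
norm₁-vec S = refl

norm₁≡1⇒vec : ∀ v → norm₁ v ≡ 1 → ∃[ d ] v ≡ vec d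
norm₁≡1⇒vec (+ 1 , + 0)                 _ = E , refl
norm₁≡1⇒vec (-[1+ 0 ] , + 0)            _ = W , refl
norm₁≡1⇒vec (+ 0 , + 1)                 _ = N , refl
norm₁≡1⇒vec (+ 0 , -[1+ 0 ])            _ = S , refl
norm₁≡1⇒vec (+ 0 , + 0)                 ()
norm₁≡1⇒vec (+ 0 , + suc (suc _))       ()
norm₁≡1⇒vec (+ 0 , -[1+ suc _ ])        ()
norm₁≡1⇒vec (+ 1 , + suc _)             ()
norm₁≡1⇒vec (+ 1 , -[1+ _ ])            ()
norm₁≡1⇒vec (+ suc (suc _) , _)         ()
norm₁≡1⇒vec (-[1+ 0 ] , + suc _)        ()
norm₁≡1⇒vec (-[1+ 0 ] , -[1+ _ ])       ()
norm₁≡1⇒vec (-[1+ suc _ ] , _)          ()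

gridAdj-⊕ : ∀ w d → GridAdj w (w ⊕ d)
gridAdj-⊕ w@(x , y) d = subst (λ v → norm₁ v ≡ 1) w-[w⊕d] (norm₁-vec (opp d))
  where
  neg : ∀ x a → x - (x + a) ≡ - a
  neg = solve-∀
  w-[w⊕d] : vec (opp d) ≡ w -ᵖ (w ⊕ d)
  w-[w⊕d] = trans (vec-opp d) (sym (cong₂ _,_ (neg x _) (neg y _)))

gridAdj⇒⊕ : ∀ w b → GridAdj w b → ∃[ d ] b ≡ w ⊕ d
gridAdj⇒⊕ w@(x , y) b@(x′ , y′) adj with norm₁≡1⇒vec (w -ᵖ b) adj
... | d , w-b≡d = opp d , (begin
  b                   ≡⟨ cong₂ _,_ (back x x′) (back y y′) ⟩
  w +ᵖ -ᵖ (w -ᵖ b)    ≡⟨ cong (λ v → w +ᵖ -ᵖ v) w-b≡d ⟩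
  w +ᵖ -ᵖ vec d       ≡⟨ cong (w +ᵖ_) (sym (vec-opp d)) ⟩
  w ⊕ opp d           ∎)
  where
  open ≡-Reasoning
  back : ∀ x x′ → x′ ≡ x + - (x - x′)
  back = solve-∀

dotAt-⊕ : ∀ w d₁ d₂ → dotAt w (w ⊕ d₁) (w ⊕ d₂) ≡ vec d₁ · vec d₂
dotAt-⊕ w d₁ d₂ = dotAt-+ᵖ w (vec d₁) (vec d₂)

-- Parity of the coordinate sum

∣m⊖n∣%2≡[m+n]%2 : ∀ m n → ∣ m ⊖ n ∣ % 2 ≡ (m ℕ.+ n) % 2
∣m⊖n∣%2≡[m+n]%2 zero    zero    = refl
∣m⊖n∣%2≡[m+n]%2 zero    (suc n) = refl
∣m⊖n∣%2≡[m+n]%2 (suc m) zero    = cong (_% 2) (sym (ℕP.+-identityʳ (suc m)))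
∣m⊖n∣%2≡[m+n]%2 (suc m) (suc n) = begin
  ∣ suc m ⊖ suc n ∣ % 2       ≡⟨ cong (λ i → ∣ i ∣ % 2) (ℤP.[1+m]⊖[1+n]≡m⊖n m n) ⟩
  ∣ m ⊖ n ∣ % 2               ≡⟨ ∣m⊖n∣%2≡[m+n]%2 m n ⟩
  (m ℕ.+ n) % 2               ≡⟨ sym ([m+kn]%n≡m%n (m ℕ.+ n) 1 2) ⟩
  (m ℕ.+ n ℕ.+ 2) % 2         ≡⟨ cong (_% 2) (ℕP.+-comm (m ℕ.+ n) 2) ⟩
  suc (suc (m ℕ.+ n)) % 2     ≡⟨ cong (λ k → suc k % 2) (sym (ℕP.+-suc m n)) ⟩
  (suc m ℕ.+ suc n) % 2       ∎
  where open ≡-Reasoning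

∣i+j∣%2≡[∣i∣+∣j∣]%2 : ∀ i j → ∣ i + j ∣ % 2 ≡ (∣ i ∣ ℕ.+ ∣ j ∣) % 2
∣i+j∣%2≡[∣i∣+∣j∣]%2 (+ m)    (+ n)    = refl
∣i+j∣%2≡[∣i∣+∣j∣]%2 (+ m)    -[1+ n ] = ∣m⊖n∣%2≡[m+n]%2 m (suc n)
∣i+j∣%2≡[∣i∣+∣j∣]%2 -[1+ m ] (+ n)    = trans (∣m⊖n∣%2≡[m+n]%2 n (suc m)) (cong (_% 2) (ℕP.+-comm n (suc m)))
∣i+j∣%2≡[∣i∣+∣j∣]%2 -[1+ m ] -[1+ n ] = cong (λ k → suc k % 2) (sym (ℕP.+-suc m n))

black+ᵖwhite⇒white : ∀ p q → Black p → White q → White (p +ᵖ q)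
black+ᵖwhite⇒white (x , y) (x′ , y′) black white = begin
  ∣ x + x′ + (y + y′) ∣ % 2                       ≡⟨ cong (λ i → ∣ i ∣ % 2) (regroup x x′ y y′) ⟩
  ∣ x + y + (x′ + y′) ∣ % 2                       ≡⟨ ∣i+j∣%2≡[∣i∣+∣j∣]%2 (x + y) (x′ + y′) ⟩
  (∣ x + y ∣ ℕ.+ ∣ x′ + y′ ∣) % 2                 ≡⟨ %-distribˡ-+ ∣ x + y ∣ ∣ x′ + y′ ∣ 2 ⟩
  (∣ x + y ∣ % 2 ℕ.+ ∣ x′ + y′ ∣ % 2) % 2         ≡⟨ cong₂ (λ a b → (a ℕ.+ b) % 2) black white ⟩
  1                                               ∎
  where
  open ≡-Reasoning
  regroup : ∀ x x′ y y′ → x + x′ + (y + y′) ≡ x + y + (x′ + y′)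
  regroup = solve-∀

white-ᵖwhite⇒black : ∀ p q → White p → White q → Black (q -ᵖ p)
white-ᵖwhite⇒black (x , y) (x′ , y′) white white′ = begin
  ∣ x′ - x + (y′ - y) ∣ % 2                          ≡⟨ cong (λ i → ∣ i ∣ % 2) (regroup x x′ y y′) ⟩
  ∣ x′ + y′ + - (x + y) ∣ % 2                        ≡⟨ ∣i+j∣%2≡[∣i∣+∣j∣]%2 (x′ + y′) (- (x + y)) ⟩
  (∣ x′ + y′ ∣ ℕ.+ ∣ - (x + y) ∣) % 2                ≡⟨ %-distribˡ-+ ∣ x′ + y′ ∣ ∣ - (x + y) ∣ 2 ⟩
  (∣ x′ + y′ ∣ % 2 ℕ.+ ∣ - (x + y) ∣ % 2) % 2        ≡⟨ cong (λ k → (∣ x′ + y′ ∣ % 2 ℕ.+ k % 2) % 2)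
                                                             (ℤP.∣-i∣≡∣i∣ (x + y)) ⟩
  (∣ x′ + y′ ∣ % 2 ℕ.+ ∣ x + y ∣ % 2) % 2            ≡⟨ cong₂ (λ a b → (a ℕ.+ b) % 2) white′ white ⟩
  0                                                  ∎
  where
  open ≡-Reasoning
  regroup : ∀ x x′ y y′ → x′ - x + (y′ - y) ≡ x′ + y′ + - (x + y)
  regroup = solve-∀

vec-white : ∀ d → White (vec d)
vec-white E = refl
vec-white W = refl
vec-white N = refl
vec-white S = refl

Σ-xor : (Dir → Bool) → Bool
Σ-xor f = f E xor f W xor f N xor f S

BW≡Σ-xor : ∀ u w → BW u w ≡ Σ-xor (λ d → u (w ⊕ d))
BW≡Σ-xor u (x , y) rewrite ℤP.+-identityʳ x | ℤP.+-identityʳ y = refl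

kernel-forces-opposite : ∀ e (f : Dir → Bool) → f (opp e) ≡ true → f (rot e) ≡ false → f (opp (rot e)) ≡ false →
                         Σ-xor f ≡ false → f e ≡ true
kernel-forces-opposite E f fW fN fS rewrite fW | fN | fS with f E
... | true  = λ _ → refl
... | false = λ ()
kernel-forces-opposite W f fE fS fN rewrite fE | fS | fN with f W
... | true  = λ _ → refl
... | false = λ ()
kernel-forces-opposite N f fS fW fE rewrite fS | fW | fE with f N
... | true  = λ _ → refl
... | false = λ ()
kernel-forces-opposite S f fN fE fW rewrite fN | fE | fW with f S
... | true  = λ _ → refl
... | false = λ ()

Linked : (Point → Bool) → Point → Point → Point → Set
Linked u w b c = dotAt w b c ≡ + 0 ⊎ (∀ b′ → GridAdj w b′ → Active u b′ → b′ ≡ b ⊎ b′ ≡ c)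

partner-direction : ∀ {m n u w} → InKerBW m n u → InR m n w → White w → ∀ e → Active u (w ⊕ opp e) →
                    ∃[ f ] (+ 0 ≤ vec e · vec f × Active u (w ⊕ f) × Linked u w (w ⊕ opp e) (w ⊕ f))
partner-direction {u = u} {w} ker inR white e active
  with ·-table e | u (w ⊕ rot e) in rot-on | u (w ⊕ opp (rot e)) in rot′-on
... | _ , _ , e·r , _ , o·r , _ | true | _ =
  rot e , ℤP.≤-reflexive (sym e·r) , rot-on , inj₁ (trans (dotAt-⊕ w (opp e) (rot e)) o·r)
... | _ , _ , _ , e·r′ , _ , o·r′ | false | true =
  opp (rot e) , ℤP.≤-reflexive (sym e·r′) , rot′-on , inj₁ (trans (dotAt-⊕ w (opp e) (opp (rot e))) o·r′)
... | e·e , _ | false | false = e , subst (+ 0 ≤_) (sym e·e) (+≤+ z≤n) , forced , inj₂ only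
  where
  forced : u (w ⊕ e) ≡ true
  forced = kernel-forces-opposite e (λ d → u (w ⊕ d)) active rot-on rot′-on
             (trans (sym (BW≡Σ-xor u w)) (ker w inR white))
  on≢off : ∀ {p q} → p ≡ q → u p ≡ true → u q ≡ false → ⊥
  on≢off refl on off = contradiction (trans (sym on) off) λ ()
  only : ∀ b → GridAdj w b → Active u b → b ≡ w ⊕ opp e ⊎ b ≡ w ⊕ e
  only b adj on with gridAdj⇒⊕ w b adj
  ... | d , refl with dir-cases e d
  ...   | inj₁ d≡e                  = inj₂ (cong (w +ᵖ_) d≡e)
  ...   | inj₂ (inj₁ d≡opp)         = inj₁ (cong (w +ᵖ_) d≡opp)
  ...   | inj₂ (inj₂ (inj₁ d≡rot))  = ⊥-elim (on≢off (cong (w +ᵖ_) d≡rot) on rot-on)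
  ...   | inj₂ (inj₂ (inj₂ d≡rot′)) = ⊥-elim (on≢off (cong (w +ᵖ_) d≡rot′) on rot′-on)

partner-at : ∀ {m n u w} → InKerBW m n u → InR m n w → White w → ∀ e → Active u (w ⊕ opp e) →
             ∃[ c ] (vec e · (w ⊕ opp e) < vec e · c × AdjA m n u (w ⊕ opp e) c)
partner-at {w = w} ker inR white e active with partner-direction ker inR white e active | ·-table e
... | f , 0≤e·f , on , linked | _ , e·opp , _ =
  w ⊕ f , b<c , active , on , (λ b≡c → ℤP.<⇒≢ b<c (cong (vec e ·_) b≡c)) ,
  w , inR , white , gridAdj-⊕ w (opp e) , gridAdj-⊕ w f , linked
  where
  open ℤP.≤-Reasoning
  b<c : vec e · (w ⊕ opp e) < vec e · (w ⊕ f)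
  b<c = begin-strict
    vec e · (w ⊕ opp e)              ≡⟨ ·-distrib-+ᵖ (vec e) w (vec (opp e)) ⟩
    vec e · w + vec e · vec (opp e)  ≡⟨ cong (_+_ (vec e · w)) e·opp ⟩
    vec e · w + -[1+ 0 ]             <⟨ ℤP.+-monoʳ-< (vec e · w) (ℤP.<-≤-trans -<+ 0≤e·f) ⟩
    vec e · w + vec e · vec f        ≡⟨ sym (·-distrib-+ᵖ (vec e) w (vec f)) ⟩
    vec e · (w ⊕ f)                  ∎

partner-beyond : ∀ {m n u b} → InKerBW m n u → Black b → Active u b → ∀ e → InR m n (b ⊕ e) →
                 ∃[ c ] (vec e · b < vec e · c × AdjA m n u b c)
partner-beyond {m} {n} {u} {b} ker black active e inR =
  subst (λ b → ∃[ c ] (vec e · b < vec e · c × AdjA m n u b c)) (⊕-opp b e)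
    (partner-at ker inR (black+ᵖwhite⇒white b (vec e) black (vec-white e)) e
                (subst (Active u) (sym (⊕-opp b e)) active))

opposite-sides⇒≢ : ∀ e {b c c′} → vec e · b < vec e · c → vec (opp e) · b < vec (opp e) · c′ → c ≢ c′
opposite-sides⇒≢ e {b} {c} b<c b<c′ refl =
  ℤP.<-asym b<c (ℤP.neg-cancel-< (subst₂ _<_ (opp-· b) (opp-· c) b<c′))
  where
  opp-· : ∀ p → vec (opp e) · p ≡ - (vec e · p)
  opp-· p = trans (cong (_· p) (vec-opp e)) (·-negˡ (vec e) p)

InRange : ℕ → ℤ → Set
InRange m x = + 0 ≤ x × x < + m

InRange-+0 : ∀ {m x} → InRange m x → InRange m (x + + 0)
InRange-+0 {m} {x} = subst (InRange m) (sym (ℤP.+-identityʳ x))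

data Position (m : ℕ) (x : ℤ) : Set where
  boundary : x ≡ + 0 ⊎ x ≡ + (m ℕ.∸ 1) → Position m x
  inner    : InRange m (x + + 1) → InRange m (x - + 1) → Position m x

position : ∀ m x → InRange m x → Position m x
position m (+ 0)     _            = boundary (inj₁ refl)
position m (+ suc i) (_ , +<+ i<m) with suc (suc i) ℕ.<? m
... | yes i+2<m = inner (+≤+ z≤n , +<+ (subst (ℕ._< m) (sym (ℕP.+-comm (suc i) 1)) i+2<m))
                        (+≤+ z≤n , +<+ (ℕP.<-trans (ℕP.n<1+n i) i<m))
... | no  i+2≮m = boundary (inj₂ (cong (λ k → + (k ℕ.∸ 1)) (ℕP.≤-antisym i<m (ℕP.≮⇒≥ i+2≮m))))

corner : ∀ {m n x y} → x ≡ + 0 ⊎ x ≡ + (m ℕ.∸ 1) → y ≡ + 0 ⊎ y ≡ + (n ℕ.∸ 1) → Corner m n (x , y)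
corner (inj₁ refl) (inj₁ refl) = inj₁ refl
corner (inj₂ refl) (inj₁ refl) = inj₂ (inj₁ refl)
corner (inj₁ refl) (inj₂ refl) = inj₂ (inj₂ (inj₁ refl))
corner (inj₂ refl) (inj₂ refl) = inj₂ (inj₂ (inj₂ refl))

opposite-neighbours-in-R : ∀ {m n b} → InR m n b → ¬ Corner m n b → ∃[ e ] (InR m n (b ⊕ e) × InR m n (b ⊕ opp e))
opposite-neighbours-in-R {m} {n} {x , y} (x∈ , y∈) ¬corner with position m x x∈ | position n y y∈
... | inner x₊ x₋ | _           = E , (x₊ , InRange-+0 y∈) , (x₋ , InRange-+0 y∈)
... | boundary _  | inner y₊ y₋ = N , (InRange-+0 x∈ , y₊) , (InRange-+0 x∈ , y₋)
... | boundary bx | boundary by = ⊥-elim (¬corner (corner {m} {n} bx by))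

two-adjacent : ∀ {m n u b} → BlackFun m n u → InKerBW m n u → Active u b → ¬ Corner m n b →
               ∃[ c ] ∃[ c′ ] (c ≢ c′ × AdjA m n u b c × AdjA m n u b c′)
two-adjacent blackFun ker active ¬corner =
  let inR , black      = blackFun _ active
      e , inR₊ , inR₋  = opposite-neighbours-in-R inR ¬corner
      c , b<c , adj    = partner-beyond ker black active e inR₊
      c′ , b<c′ , adj′ = partner-beyond ker black active (opp e) inR₋
  in c , c′ , opposite-sides⇒≢ e b<c b<c′ , adj , adj′

-- Disjointness of segments through a separating functional

along : ℤ → ℤ → Point → Point → Point
along D μ (x₁ , y₁) (x₂ , y₂) = (D * x₁ + μ * (x₂ - x₁) , D * y₁ + μ * (y₂ - y₁))

ScaledMeet : Point → Point → Point → Point → Set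
ScaledMeet b₁ b₂ b₃ b₄ = ∃[ D ] ∃[ μ ] ∃[ ν ]
  (+ 0 < D × (+ 0 ≤ μ × μ ≤ D) × (+ 0 ≤ ν × ν ≤ D) × along D μ b₁ b₂ ≡ along D ν b₃ b₄)

_/1 : ℤ → ℚᵘ
z /1 = mkℚᵘ z 0

toℚᵘ-affine : ∀ p s q →
  ℚ.toℚᵘ (toℚ p ℚ.+ s ℚ.* (toℚ q ℚ.- toℚ p)) ≃ p /1 +ᵘ ℚ.toℚᵘ s *ᵘ (q /1 -ᵘ p /1)
toℚᵘ-affine p s q = begin
  ℚ.toℚᵘ (toℚ p ℚ.+ s ℚ.* (toℚ q ℚ.- toℚ p))
    ≈⟨ ℚP.toℚᵘ-homo-+ (toℚ p) _ ⟩
  ℚ.toℚᵘ (toℚ p) +ᵘ ℚ.toℚᵘ (s ℚ.* (toℚ q ℚ.- toℚ p))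
    ≈⟨ ℚᵘP.+-cong (toℚᵘ-toℚ p) (ℚP.toℚᵘ-homo-* s _) ⟩
  p /1 +ᵘ ℚ.toℚᵘ s *ᵘ ℚ.toℚᵘ (toℚ q ℚ.- toℚ p)
    ≈⟨ ℚᵘP.+-congʳ (p /1) (ℚᵘP.*-congˡ {ℚ.toℚᵘ s} difference) ⟩
  p /1 +ᵘ ℚ.toℚᵘ s *ᵘ (q /1 -ᵘ p /1)
    ∎
  where
  open ℚᵘP.≃-Reasoning
  toℚᵘ-toℚ : ∀ z → ℚ.toℚᵘ (toℚ z) ≃ z /1
  toℚᵘ-toℚ z = ℚP.toℚᵘ-fromℚᵘ (z /1)
  difference : ℚ.toℚᵘ (toℚ q ℚ.- toℚ p) ≃ q /1 -ᵘ p /1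
  difference = ℚᵘP.≃-trans (ℚP.toℚᵘ-homo-+ (toℚ q) _)
    (ℚᵘP.+-cong (toℚᵘ-toℚ q) (ℚᵘP.≃-trans (ℚP.toℚᵘ-homo‿- (toℚ p)) (ℚᵘP.-‿cong (toℚᵘ-toℚ p))))

-- The right-hand sides of lhs and rhs are the two sides of ℚᵘ._≃_, cross-multiplied, as they compute.
cleared-coordinate : ∀ a A c C x₁ x₂ x₃ x₄ →
  x₁ /1 +ᵘ mkℚᵘ a A *ᵘ (x₂ /1 -ᵘ x₁ /1) ≃ x₃ /1 +ᵘ mkℚᵘ c C *ᵘ (x₄ /1 -ᵘ x₃ /1) →
  (+ suc A * + suc C) * x₁ + (a * + suc C) * (x₂ - x₁) ≡ (+ suc A * + suc C) * x₃ + (c * + suc A) * (x₄ - x₃)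
cleared-coordinate a A c C x₁ x₂ x₃ x₄ (ℚᵘ.*≡* eq) =
  trans (lhs a (+ suc A) (+ suc C) x₁ x₂) (trans eq (rhs c (+ suc A) (+ suc C) x₃ x₄))
  where
  lhs : ∀ a α γ x₁ x₂ → (α * γ) * x₁ + (a * γ) * (x₂ - x₁)
                       ≡ (x₁ * (α * (+ 1 * + 1)) + (a * (x₂ * + 1 + - x₁ * + 1)) * + 1) * (+ 1 * (γ * (+ 1 * + 1)))
  lhs = solve-∀
  rhs : ∀ c α γ x₃ x₄ → (x₃ * (γ * (+ 1 * + 1)) + (c * (x₄ * + 1 + - x₃ * + 1)) * + 1) * (+ 1 * (α * (+ 1 * + 1)))
                       ≡ (α * γ) * x₃ + (c * α) * (x₄ - x₃)
  rhs = solve-∀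

segmentsMeet⇒scaledMeet : ∀ b₁ b₂ b₃ b₄ → SegmentsMeet b₁ b₂ b₃ b₄ → ScaledMeet b₁ b₂ b₃ b₄
segmentsMeet⇒scaledMeet (x₁ , y₁) (x₂ , y₂) (x₃ , y₃) (x₄ , y₄)
  (s@(ℚ.mkℚ a A _) , t@(ℚ.mkℚ c C _) , ℚ.*≤* 0≤s , ℚ.*≤* s≤1 , ℚ.*≤* 0≤t , ℚ.*≤* t≤1 , eqx , eqy) =
  + suc A * + suc C , a * + suc C , c * + suc A , +<+ (s≤s z≤n) ,
  (ℤP.*-monoʳ-≤-nonNeg (+ suc C) 0≤a , ℤP.*-monoʳ-≤-nonNeg (+ suc C) a≤A) ,
  (ℤP.*-monoʳ-≤-nonNeg (+ suc A) 0≤c ,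
   subst (c * + suc A ≤_) (ℤP.*-comm (+ suc C) (+ suc A)) (ℤP.*-monoʳ-≤-nonNeg (+ suc A) c≤C)) ,
  cong₂ _,_ (coordinate x₁ x₂ x₃ x₄ eqx) (coordinate y₁ y₂ y₃ y₄ eqy)
  where
  0≤a : + 0 ≤ a
  0≤a = subst (+ 0 ≤_) (ℤP.*-identityʳ a) 0≤s
  a≤A : a ≤ + suc A
  a≤A = subst₂ _≤_ (ℤP.*-identityʳ a) (ℤP.*-identityˡ (+ suc A)) s≤1
  0≤c : + 0 ≤ c
  0≤c = subst (+ 0 ≤_) (ℤP.*-identityʳ c) 0≤t
  c≤C : c ≤ + suc C
  c≤C = subst₂ _≤_ (ℤP.*-identityʳ c) (ℤP.*-identityˡ (+ suc C)) t≤1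
  coordinate : ∀ x₁ x₂ x₃ x₄ →
    toℚ x₁ ℚ.+ s ℚ.* (toℚ x₂ ℚ.- toℚ x₁) ≡ toℚ x₃ ℚ.+ t ℚ.* (toℚ x₄ ℚ.- toℚ x₃) →
    (+ suc A * + suc C) * x₁ + (a * + suc C) * (x₂ - x₁) ≡ (+ suc A * + suc C) * x₃ + (c * + suc A) * (x₄ - x₃)
  coordinate x₁ x₂ x₃ x₄ eq = cleared-coordinate a A c C x₁ x₂ x₃ x₄
    (ℚᵘP.≃-trans (ℚᵘP.≃-sym (toℚᵘ-affine x₁ s x₂))
                 (ℚᵘP.≃-trans (ℚP.toℚᵘ-cong eq) (toℚᵘ-affine x₃ t x₄)))

·-along : ∀ ℓ D μ p q → ℓ · along D μ p q ≡ D * (ℓ · p) + μ * (ℓ · q - ℓ · p)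
·-along (a , b) D μ (x₁ , y₁) (x₂ , y₂) = begin
  a * (D * x₁ + μ * (x₂ - x₁)) + b * (D * y₁ + μ * (y₂ - y₁))
    ≡⟨ solve (a ∷ b ∷ D ∷ μ ∷ x₁ ∷ y₁ ∷ x₂ ∷ y₂ ∷ []) ⟩
  D * (a * x₁ + b * y₁) + μ * (a * x₂ + b * y₂ - (a * x₁ + b * y₁))
    ∎
  where open ≡-Reasoning

along-≤ : ∀ {D μ α β c} → + 0 ≤ μ → μ ≤ D → α ≤ c → β ≤ c → D * α + μ * (β - α) ≤ D * c
along-≤ {D} {μ} {α} {β} {c} 0≤μ μ≤D α≤c β≤c = begin
  D * α + μ * (β - α)  ≡⟨ solve (D ∷ μ ∷ α ∷ β ∷ []) ⟩
  (D - μ) * α + μ * β  ≤⟨ ℤP.+-mono-≤ (ℤP.*-monoˡ-≤-nonNeg (D - μ) {{nonNegative (ℤP.i≤j⇒0≤j-i μ≤D)}} α≤c)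
                                      (ℤP.*-monoˡ-≤-nonNeg μ {{nonNegative 0≤μ}} β≤c) ⟩
  (D - μ) * c + μ * c  ≡⟨ solve (D ∷ μ ∷ c ∷ []) ⟩
  D * c                ∎
  where open ℤP.≤-Reasoning

along-≥ : ∀ {D μ α β c} → + 0 ≤ μ → μ ≤ D → c ≤ α → c ≤ β → D * c ≤ D * α + μ * (β - α)
along-≥ {D} {μ} {α} {β} {c} 0≤μ μ≤D c≤α c≤β = begin
  D * c                ≡⟨ solve (D ∷ μ ∷ c ∷ []) ⟩
  (D - μ) * c + μ * c  ≤⟨ ℤP.+-mono-≤ (ℤP.*-monoˡ-≤-nonNeg (D - μ) {{nonNegative (ℤP.i≤j⇒0≤j-i μ≤D)}} c≤α)
                                      (ℤP.*-monoˡ-≤-nonNeg μ {{nonNegative 0≤μ}} c≤β) ⟩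
  (D - μ) * α + μ * β  ≡⟨ solve (D ∷ μ ∷ α ∷ β ∷ []) ⟩
  D * α + μ * (β - α)  ∎
  where open ℤP.≤-Reasoning

SeparatedBy : Point → Point → Point → Point → Point → Set
SeparatedBy ℓ b₁ b₂ b₃ b₄ = (ℓ · b₁) ⊔ (ℓ · b₂) < (ℓ · b₃) ⊓ (ℓ · b₄)

separated⇒disjoint : ∀ ℓ b₁ b₂ b₃ b₄ → SeparatedBy ℓ b₁ b₂ b₃ b₄ → ¬ SegmentsMeet b₁ b₂ b₃ b₄
separated⇒disjoint ℓ b₁ b₂ b₃ b₄ separated meet with segmentsMeet⇒scaledMeet b₁ b₂ b₃ b₄ meet
... | D , μ , ν , 0<D , (0≤μ , μ≤D) , (0≤ν , ν≤D) , P≡Q = ℤP.<-irrefl (cong (ℓ ·_) P≡Q) (begin-strict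
  ℓ · along D μ b₁ b₂
    ≡⟨ ·-along ℓ D μ b₁ b₂ ⟩
  D * (ℓ · b₁) + μ * (ℓ · b₂ - ℓ · b₁)
    ≤⟨ along-≤ 0≤μ μ≤D (ℤP.i≤i⊔j (ℓ · b₁) (ℓ · b₂)) (ℤP.i≤j⊔i (ℓ · b₁) (ℓ · b₂)) ⟩
  D * ((ℓ · b₁) ⊔ (ℓ · b₂))
    <⟨ ℤP.*-monoˡ-<-pos D {{positive 0<D}} separated ⟩
  D * ((ℓ · b₃) ⊓ (ℓ · b₄))
    ≤⟨ along-≥ 0≤ν ν≤D (ℤP.i⊓j≤i (ℓ · b₃) (ℓ · b₄)) (ℤP.i⊓j≤j (ℓ · b₃) (ℓ · b₄)) ⟩
  D * (ℓ · b₃) + ν * (ℓ · b₄ - ℓ · b₃)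
    ≡⟨ sym (·-along ℓ D ν b₃ b₄) ⟩
  ℓ · along D ν b₃ b₄
    ∎)
  where open ℤP.≤-Reasoning

separatedBy-+ᵖ : ∀ ℓ w r₁ r₂ r₃ r₄ → SeparatedBy ℓ r₁ r₂ r₃ r₄ →
                 SeparatedBy ℓ (w +ᵖ r₁) (w +ᵖ r₂) (w +ᵖ r₃) (w +ᵖ r₄)
separatedBy-+ᵖ ℓ w r₁ r₂ r₃ r₄ separated = begin-strict
  (ℓ · (w +ᵖ r₁)) ⊔ (ℓ · (w +ᵖ r₂))    ≡⟨ cong₂ _⊔_ (·-distrib-+ᵖ ℓ w r₁) (·-distrib-+ᵖ ℓ w r₂) ⟩
  (ℓ · w + ℓ · r₁) ⊔ (ℓ · w + ℓ · r₂)  ≡⟨ sym (shift-⊔ (ℓ · r₁) (ℓ · r₂)) ⟩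
  ℓ · w + ((ℓ · r₁) ⊔ (ℓ · r₂))        <⟨ ℤP.+-monoʳ-< (ℓ · w) separated ⟩
  ℓ · w + ((ℓ · r₃) ⊓ (ℓ · r₄))        ≡⟨ shift-⊓ (ℓ · r₃) (ℓ · r₄) ⟩
  (ℓ · w + ℓ · r₃) ⊓ (ℓ · w + ℓ · r₄)  ≡⟨ sym (cong₂ _⊓_ (·-distrib-+ᵖ ℓ w r₃) (·-distrib-+ᵖ ℓ w r₄)) ⟩
  (ℓ · (w +ᵖ r₃)) ⊓ (ℓ · (w +ᵖ r₄))    ∎
  where
  open ℤP.≤-Reasoning
  shift-⊔ : ∀ i j → ℓ · w + (i ⊔ j) ≡ (ℓ · w + i) ⊔ (ℓ · w + j)
  shift-⊔ = ℤP.mono-<-distrib-⊔ (_+_ (ℓ · w)) (ℤP.+-monoʳ-< (ℓ · w))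
  shift-⊓ : ∀ i j → ℓ · w + (i ⊓ j) ≡ (ℓ · w + i) ⊓ (ℓ · w + j)
  shift-⊓ = ℤP.mono-<-distrib-⊓ (_+_ (ℓ · w)) (ℤP.+-monoʳ-< (ℓ · w))

Distinct₄ : Point → Point → Point → Point → Set
Distinct₄ a b c d = a ≢ b × a ≢ c × a ≢ d × b ≢ c × b ≢ d × c ≢ d

distinct₄? : ∀ a b c d → Dec (Distinct₄ a b c d)
distinct₄? a b c d =
  ¬? (a ≟ᵖ b) ×-dec ¬? (a ≟ᵖ c) ×-dec ¬? (a ≟ᵖ d) ×-dec ¬? (b ≟ᵖ c) ×-dec ¬? (b ≟ᵖ d) ×-dec ¬? (c ≟ᵖ d)

Distinct₄-+ᵖ : ∀ w {a b c d} → Distinct₄ (w +ᵖ a) (w +ᵖ b) (w +ᵖ c) (w +ᵖ d) → Distinct₄ a b c d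
Distinct₄-+ᵖ w (a≢b , a≢c , a≢d , b≢c , b≢d , c≢d) =
  translate a≢b , translate a≢c , translate a≢d , translate b≢c , translate b≢d , translate c≢d
  where
  translate : ∀ {p q} → w +ᵖ p ≢ w +ᵖ q → p ≢ q
  translate w+p≢w+q = w+p≢w+q ∘ cong (w +ᵖ_)

-- Two adjacent pairs around white points 0ᵖ and v, with the hypotheses that survive translation.
Admissible : Point → Dir → Dir → Dir → Dir → Set
Admissible v d₁ d₂ d₃ d₄ =
  Distinct₄ (vec d₁) (vec d₂) (v ⊕ d₃) (v ⊕ d₄) × Black v × (v ≡ 0ᵖ → vec d₁ · vec d₂ ≡ + 0)

admissible? : ∀ v d₁ d₂ d₃ d₄ → Dec (Admissible v d₁ d₂ d₃ d₄)
admissible? v@(p , q) d₁ d₂ d₃ d₄ =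
  distinct₄? (vec d₁) (vec d₂) (v ⊕ d₃) (v ⊕ d₄) ×-dec (∣ p + q ∣ % 2 ℕ.≟ 0)
    ×-dec ((v ≟ᵖ 0ᵖ) →-dec (vec d₁ · vec d₂ ℤP.≟ + 0))

functionals : List Point
functionals = vec E ∷ vec W ∷ vec N ∷ vec S
            ∷ (+ 1 , + 1) ∷ (+ 1 , -[1+ 0 ]) ∷ (-[1+ 0 ] , + 1) ∷ (-[1+ 0 ] , -[1+ 0 ]) ∷ []

Separable : Point → Dir → Dir → Dir → Dir → Set
Separable v d₁ d₂ d₃ d₄ = Any (λ ℓ → SeparatedBy ℓ (vec d₁) (vec d₂) (v ⊕ d₃) (v ⊕ d₄)) functionals

separable? : ∀ v d₁ d₂ d₃ d₄ → Dec (Separable v d₁ d₂ d₃ d₄)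
separable? v d₁ d₂ d₃ d₄ =
  any? (λ ℓ → (ℓ · vec d₁) ⊔ (ℓ · vec d₂) ℤP.<? (ℓ · (v ⊕ d₃)) ⊓ (ℓ · (v ⊕ d₄))) functionals

small : List ℤ
small = -[1+ 1 ] ∷ -[1+ 0 ] ∷ + 0 ∷ + 1 ∷ + 2 ∷ []

small-or-far : ∀ i → i ∈ small ⊎ (+ 3 ≤ i ⊎ i ≤ -[1+ 2 ])
small-or-far -[1+ 1 ]              = inj₁ (here refl)
small-or-far -[1+ 0 ]              = inj₁ (there (here refl))
small-or-far (+ 0)                 = inj₁ (there (there (here refl)))
small-or-far (+ 1)                 = inj₁ (there (there (there (here refl))))
small-or-far (+ 2)                 = inj₁ (there (there (there (there (here refl)))))
small-or-far (+ suc (suc (suc _))) = inj₂ (inj₁ (+≤+ (s≤s (s≤s (s≤s z≤n)))))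
small-or-far -[1+ suc (suc _) ]    = inj₂ (inj₂ (-≤- (s≤s (s≤s z≤n))))

small-admissible⇒separable :
  All (λ p → All (λ q → ∀ d₁ d₂ d₃ d₄ → Admissible (p , q) d₁ d₂ d₃ d₄ → Separable (p , q) d₁ d₂ d₃ d₄)
                 small)
      small
small-admissible⇒separable = from-yes (all? (λ p → all? (λ q →
  ∀-Dir? λ d₁ → ∀-Dir? λ d₂ → ∀-Dir? λ d₃ → ∀-Dir? λ d₄ →
    admissible? (p , q) d₁ d₂ d₃ d₄ →-dec separable? (p , q) d₁ d₂ d₃ d₄) small) small)

·-bounded : ∀ e d → -[1+ 0 ] ≤ vec e · vec d × vec e · vec d ≤ + 1
·-bounded = from-yes (∀-Dir? λ e → ∀-Dir? λ d → (-[1+ 0 ] ℤP.≤? vec e · vec d) ×-dec (vec e · vec d ℤP.≤? + 1))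

far-separated : ∀ e v d₁ d₂ d₃ d₄ → + 3 ≤ vec e · v → SeparatedBy (vec e) (vec d₁) (vec d₂) (v ⊕ d₃) (v ⊕ d₄)
far-separated e v d₁ d₂ d₃ d₄ 3≤e·v = begin-strict
  (vec e · vec d₁) ⊔ (vec e · vec d₂)         ≤⟨ ℤP.⊔-lub (proj₂ (·-bounded e d₁)) (proj₂ (·-bounded e d₂)) ⟩
  + 1                                         <⟨ +<+ (s≤s (s≤s z≤n)) ⟩
  + 2                                         ≤⟨ ℤP.⊓-glb (beyond d₃) (beyond d₄) ⟩
  (vec e · (v ⊕ d₃)) ⊓ (vec e · (v ⊕ d₄))     ∎
  where
  open ℤP.≤-Reasoning
  beyond : ∀ d → + 2 ≤ vec e · (v ⊕ d)
  beyond d = begin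
    + 3 + -[1+ 0 ]             ≤⟨ ℤP.+-mono-≤ 3≤e·v (proj₁ (·-bounded e d)) ⟩
    vec e · v + vec e · vec d  ≡⟨ sym (·-distrib-+ᵖ (vec e) v (vec d)) ⟩
    vec e · (v ⊕ d)            ∎

·-axes : ∀ p q → vec E · (p , q) ≡ p × vec W · (p , q) ≡ - p × vec N · (p , q) ≡ q × vec S · (p , q) ≡ - q
·-axes p q = east p q , west p q , north p q , south p q
  where
  east : ∀ p q → + 1 * p + + 0 * q ≡ p
  east = solve-∀
  west : ∀ p q → -[1+ 0 ] * p + + 0 * q ≡ - p
  west = solve-∀
  north : ∀ p q → + 0 * p + + 1 * q ≡ q
  north = solve-∀
  south : ∀ p q → + 0 * p + -[1+ 0 ] * q ≡ - q
  south = solve-∀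

admissible⇒separated : ∀ v d₁ d₂ d₃ d₄ → Admissible v d₁ d₂ d₃ d₄ →
                       ∃[ ℓ ] SeparatedBy ℓ (vec d₁) (vec d₂) (v ⊕ d₃) (v ⊕ d₄)
admissible⇒separated v@(p , q) d₁ d₂ d₃ d₄ admissible
  with small-or-far p | small-or-far q | ·-axes p q
... | inj₂ (inj₁ 3≤p)  | _ | e·v , _ =
  vec E , far-separated E v d₁ d₂ d₃ d₄ (subst (+ 3 ≤_) (sym e·v) 3≤p)
... | inj₂ (inj₂ p≤-3) | _ | _ , w·v , _ =
  vec W , far-separated W v d₁ d₂ d₃ d₄ (subst (+ 3 ≤_) (sym w·v) (ℤP.neg-mono-≤ p≤-3))
... | inj₁ _ | inj₂ (inj₁ 3≤q)  | _ , _ , n·v , _ =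
  vec N , far-separated N v d₁ d₂ d₃ d₄ (subst (+ 3 ≤_) (sym n·v) 3≤q)
... | inj₁ _ | inj₂ (inj₂ q≤-3) | _ , _ , _ , s·v =
  vec S , far-separated S v d₁ d₂ d₃ d₄ (subst (+ 3 ≤_) (sym s·v) (ℤP.neg-mono-≤ q≤-3))
... | inj₁ p∈ | inj₁ q∈ | _ = satisfied (lookup (lookup small-admissible⇒separable p∈) q∈ d₁ d₂ d₃ d₄ admissible)

linked⇒perpendicular : ∀ {u w d₁ d₂ d₃} → w ⊕ d₁ ≢ w ⊕ d₃ → w ⊕ d₂ ≢ w ⊕ d₃ → Active u (w ⊕ d₃) →
                       Linked u w (w ⊕ d₁) (w ⊕ d₂) → vec d₁ · vec d₂ ≡ + 0
linked⇒perpendicular {w = w} {d₁} {d₂} _ _ _ (inj₁ perpendicular) = trans (sym (dotAt-⊕ w d₁ d₂)) perpendicular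
linked⇒perpendicular {w = w} {d₃ = d₃} b₁≢b₃ b₂≢b₃ on₃ (inj₂ only) =
  ⊥-elim ([ b₁≢b₃ ∘ sym , b₂≢b₃ ∘ sym ] (only (w ⊕ d₃) (gridAdj-⊕ w d₃) on₃))

admissible : ∀ {u w w′ d₁ d₂ d₃ d₄} → White w → White w′ → Distinct₄ (w ⊕ d₁) (w ⊕ d₂) (w′ ⊕ d₃) (w′ ⊕ d₄) →
             Active u (w′ ⊕ d₃) → Linked u w (w ⊕ d₁) (w ⊕ d₂) → Admissible (w′ -ᵖ w) d₁ d₂ d₃ d₄
admissible {u} {w} {w′} {d₁} {d₂} {d₃} {d₄} white white′ distinct@(_ , b₁≢b₃ , _ , b₂≢b₃ , _) on₃ linked =
  Distinct₄-+ᵖ w (subst₂ (Distinct₄ (w ⊕ d₁) (w ⊕ d₂))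
                         (sym (+ᵖ-rebase w w′ (vec d₃))) (sym (+ᵖ-rebase w w′ (vec d₄))) distinct) ,
  white-ᵖwhite⇒black w w′ white white′ ,
  λ v≡0 → same-centre (-ᵖ≡0ᵖ⇒≡ w′ w v≡0)
  where
  same-centre : w′ ≡ w → vec d₁ · vec d₂ ≡ + 0
  same-centre w′≡w = linked⇒perpendicular {u} {w} {d₁} {d₂} {d₃}
    (subst (λ x → w ⊕ d₁ ≢ x ⊕ d₃) w′≡w b₁≢b₃) (subst (λ x → w ⊕ d₂ ≢ x ⊕ d₃) w′≡w b₂≢b₃)
    (subst (λ x → Active u (x ⊕ d₃)) w′≡w on₃) linked

adjacent-segments-disjoint : ∀ {m n u b₁ b₂ b₃ b₄} → Distinct₄ b₁ b₂ b₃ b₄ →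
                             AdjA m n u b₁ b₂ → AdjA m n u b₃ b₄ → ¬ SegmentsMeet b₁ b₂ b₃ b₄
adjacent-segments-disjoint {u = u} {b₁} {b₂} {b₃} {b₄} distinct
  (_ , _ , _ , w , _ , white , w~b₁ , w~b₂ , linked) (on₃ , _ , _ , w′ , _ , white′ , w′~b₃ , w′~b₄ , _)
  with gridAdj⇒⊕ w b₁ w~b₁ | gridAdj⇒⊕ w b₂ w~b₂ | gridAdj⇒⊕ w′ b₃ w′~b₃ | gridAdj⇒⊕ w′ b₄ w′~b₄
... | d₁ , refl | d₂ , refl | d₃ , refl | d₄ , refl =
  let ℓ , separated = admissible⇒separated (w′ -ᵖ w) d₁ d₂ d₃ d₄
                        (admissible {u} {w} {w′} {d₁} {d₂} {d₃} {d₄} white white′ distinct on₃ linked)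
  in separated⇒disjoint ℓ _ _ _ _
       (subst₂ (SeparatedBy ℓ (w ⊕ d₁) (w ⊕ d₂)) (+ᵖ-rebase w w′ (vec d₃)) (+ᵖ-rebase w w′ (vec d₄))
         (separatedBy-+ᵖ ℓ w _ _ _ _ separated))

lemma2 : (m n : ℕ) → m ≥ 2 → n ≥ 2 → (u : Point → Bool) →
    BlackFun m n u → InKerBW m n u → NonZero u →
    (∀ b → Active u b → ¬ Corner m n b →
      ∃[ c ] ∃[ d ] (c ≢ d × AdjA m n u b c × AdjA m n u b d))
    × (∀ b₁ b₂ b₃ b₄ →
      b₁ ≢ b₂ → b₁ ≢ b₃ → b₁ ≢ b₄ → b₂ ≢ b₃ → b₂ ≢ b₄ → b₃ ≢ b₄ →
      Active u b₁ → Active u b₂ → Active u b₃ → Active u b₄ →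
      AdjA m n u b₁ b₂ → AdjA m n u b₃ b₄ →
      ¬ SegmentsMeet b₁ b₂ b₃ b₄)
lemma2 m n _ _ u blackFun ker _ =
  (λ b → two-adjacent blackFun ker) ,
  (λ b₁ b₂ b₃ b₄ b₁≢b₂ b₁≢b₃ b₁≢b₄ b₂≢b₃ b₂≢b₄ b₃≢b₄ _ _ _ _ →
    adjacent-segments-disjoint (b₁≢b₂ , b₁≢b₃ , b₁≢b₄ , b₂≢b₃ , b₂≢b₄ , b₃≢b₄))
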